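{- Let $d\ge -1$, let $G$ be a finite simple graph in the class $\mathcal{X}_d$, and let $e=(a,b)$ be an edge of $G$. Then the edge refinement of $G$ at $e$ is again in $\mathcal{X}_d$.
   Context: For a finite simple graph $G$, $f_k(G)$ is the number of complete subgraphs with $k+1$ vertices and $\chi(G)=\sum_{k\ge0}(-1)^kf_k(G)$. For a vertex $x$, the unit sphere $S(x)$ is the subgraph induced by the neighbors of $x$. The classes $\mathcal{X}_d$ are defined inductively: $\mathcal{X}_{ -1}$ consists only of the empty graph; for $d\ge0$, $G\in\mathcal{X}_d$ iff $\chi(G)=1+(-1)^d$ and $S(x)\in\mathcal{X}_{d-1}$ for every vertex $x$. The edge refinement of $G$ at the edge $(a,b)$ is the graph obtained by removing the edge $(a,b)$, adding a new vertex $c$, and adding the edges $(a,c)$, $(c,b)$ and $(c,z)$ for every vertex $z$ in $S(a)\cap S(b)$. -}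

module Defs where

open import Data.Nat using (ℕ; zero; suc) renaming (_≟_ to _≟ℕ_)
open import Data.Integer using (ℤ; +_; -_; _+_; _*_)
open import Data.Bool using (Bool; true; false; _∧_; _∨_; not; if_then_else_)
open import Data.Fin using (Fin; zero; suc; _≟_)
open import Data.List using (List; []; _∷_; _++_; map; allFin)
open import Data.Vec using (Vec; []; _∷_; lookup)
open import Relation.Nullary.Decidable using (⌊_⌋)
open import Relation.Binary.PropositionalEquality using (_≡_)
open import Data.Product using (_×_)
open import Data.Empty using (⊥)

record Graph : Set where
  constructor graph
  field
    n : ℕ
    V : Fin n → Bool
    E : Fin n → Fin n → Bool
open Graph public

record IsSimple (G : Graph) : Set where
  field
    sym   : ∀ i j → E G i j ≡ E G j i
    irrefl : ∀ i → E G i i ≡ false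
    inV   : ∀ i j → E G i j ≡ true → (V G i ≡ true) × (V G j ≡ true)

allᵇ : ∀ {A : Set} → (A → Bool) → List A → Bool
allᵇ p [] = true
allᵇ p (x ∷ xs) = p x ∧ allᵇ p xs

countᵇ : ∀ {A : Set} → (A → Bool) → List A → ℕ
countᵇ p [] = 0
countᵇ p (x ∷ xs) = if p x then suc (countᵇ p xs) else countᵇ p xs

_==_ : ∀ {n} → Fin n → Fin n → Bool
i == j = ⌊ i ≟ j ⌋

subsets : (n : ℕ) → List (Vec Bool n)
subsets zero = [] ∷ []
subsets (suc n) = map (true ∷_) (subsets n) ++ map (false ∷_) (subsets n)

card : ∀ {n} → Vec Bool n → ℕ
card [] = 0
card (true ∷ u) = suc (card u)
card (false ∷ u) = card u

isClique : (G : Graph) → Vec Bool (n G) → Bool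
isClique G U =
  allᵇ (λ i → not (lookup U i) ∨ V G i) (allFin (n G)) ∧
  allᵇ (λ i → allᵇ (λ j → not (lookup U i ∧ lookup U j ∧ not (i == j)) ∨ E G i j)
                 (allFin (n G))) (allFin (n G))

f : ℕ → Graph → ℕ
f k G = countᵇ (λ U → ⌊ card U ≟ℕ suc k ⌋ ∧ isClique G U) (subsets (n G))

sgn : ℕ → ℤ
sgn zero = + 1
sgn (suc k) = - sgn k

-- χ(G) = Σ_{k ≥ 0} (-1)^k f_k(G)   (f_k = 0 for k ≥ n)
sumUpTo : ℕ → (ℕ → ℤ) → ℤ
sumUpTo zero g = + 0
sumUpTo (suc m) g = sumUpTo m g + g m

χ : Graph → ℤ
χ G = sumUpTo (n G) (λ k → sgn k * (+ f k G))

S : (G : Graph) → Fin (n G) → Graph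
S G x = graph (n G) (λ z → E G x z) (λ i j → E G x i ∧ E G x j ∧ E G i j)

Fin′ : Graph → Set
Fin′ G = Fin (n G)

IsEmpty : Graph → Set
IsEmpty G = ∀ i → V G i ≡ false

-- 𝒳 k G  means  G ∈ 𝒳_{k-1}   (index shifted by one so that d = -1 is k = 0)
𝒳 : ℕ → Graph → Set
𝒳 zero G = IsEmpty G
𝒳 (suc d) G = (χ G ≡ + 1 + sgn d) × (∀ x → V G x ≡ true → 𝒳 d (S G x))

-- edge refinement at (a,b): new vertex c is 'zero', old vertex i is 'suc i'
refine : (G : Graph) → Fin (n G) → Fin (n G) → Graph
refine G a b = graph (suc (n G)) V' E'
  where
    V' : Fin (suc (n G)) → Bool
    V' zero = true
    V' (suc i) = V G i
    isAB : Fin (n G) → Bool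
    isAB z = (z == a) ∨ (z == b)
    cAdj : Fin (n G) → Bool
    cAdj z = isAB z ∨ (E G a z ∧ E G b z)
    E' : Fin (suc (n G)) → Fin (suc (n G)) → Bool
    E' zero zero = false
    E' zero (suc z) = cAdj z
    E' (suc z) zero = cAdj z
    E' (suc i) (suc j) = E G i j ∧ not (((i == a) ∧ (j == b)) ∨ ((i == b) ∧ (j == a)))

-- For d = -1 and d = 0 a graph in 𝒳_d has no edges.  For the
-- step, let G′ be the refinement of G at the edge ab, c its new vertex, and
-- W = S_{S(a)}(b) the link of ab (the common neighbours of a and b).
--   * χ: writing χ as the signed clique sum Σ_U (-1)^{|U|-1} gives the deletion
--     formula χ G = χ (G ∖ v) + 1 - χ (S v).  Deleting a and then c from G′
--     leaves G ∖ a; the sphere of c in G′ ∖ a is a cone over W, so it has χ = 1;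
--     and S_{G′}(a) ≅ S_G(a).  Hence χ G′ = χ G.
--   * spheres: S_{G′}(c) is the suspension of W, and suspension raises the
--     dimension; S_{G′}(a) ≅ S_G(a) and S_{G′}(b) ≅ S_G(b); for a common
--     neighbour z, S_{G′}(z) is the refinement of S_G(z) at ab (induction
--     hypothesis); every other sphere is unchanged.
-- These identifications are graph isomorphisms, under which χ and 𝒳 are
-- invariant (proved with the deletion formula, by induction on the number of
-- vertices).

module Submission where

open import Defs
open import Data.Nat using (ℕ; zero; suc; _≤_; _<_; z≤n; s≤s) renaming (_≟_ to _≟ℕ_; _+_ to _+ℕ_)
open import Data.Nat.Properties using (≤-refl; ≤-pred; n≮0; ≤-trans; n≤1+n; m≤n⇒m≤1+n; <-irrefl; ≤∧≢⇒<; +-mono-≤; +-mono-≤-<)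
open import Data.Integer using (ℤ; +_; -_; _+_; _*_; _-_)
import Data.Integer.Properties as ℤP
open import Data.Integer.Tactic.RingSolver using (solve-∀)
open import Data.Bool using (Bool; true; false; _∧_; _∨_; not; if_then_else_) renaming (_≟_ to _≟ᵇ_)
import Data.Bool.Properties as BP
open import Data.Fin using (Fin; zero; suc; _≟_)
open import Data.Fin.Properties using (suc-injective; 0≢1+n; any?)
open import Data.List using (List; []; _∷_; _++_; map; tabulate)
open import Data.Vec using (Vec; []; _∷_; lookup)
open import Data.Product using (_×_; _,_; proj₁; proj₂)
open import Data.Empty using (⊥; ⊥-elim)
open import Function using (_∘_; id)
open import Relation.Nullary using (¬_; Dec; yes; no)
open import Relation.Nullary.Decidable using (⌊_⌋; isYes≗does; dec-true; dec-false)
open import Relation.Binary.PropositionalEquality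

true≢false : true ≢ false
true≢false ()

∧-el : ∀ {b c} → b ∧ c ≡ true → (b ≡ true) × (c ≡ true)
∧-el {true} {true} _ = refl , refl

∧-in : ∀ {b c} → b ≡ true → c ≡ true → b ∧ c ≡ true
∧-in refl refl = refl

≢true : ∀ {b} → ¬ (b ≡ true) → b ≡ false
≢true = BP.¬-not

not≡true : ∀ {b} → not b ≡ true → b ≡ false
not≡true = BP.not-injective

bool-ext : ∀ {b c : Bool} → (b ≡ true → c ≡ true) → (c ≡ true → b ≡ true) → b ≡ c
bool-ext {true} {true} _ _ = refl
bool-ext {true} {false} f _ = sym (f refl)
bool-ext {false} {true} _ g = g refl
bool-ext {false} {false} _ _ = refl

==-refl : ∀ {m} (i : Fin m) → (i == i) ≡ true
==-refl i = trans (isYes≗does (i ≟ i)) (dec-true (i ≟ i) refl)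

==-false : ∀ {m} {i j : Fin m} → ¬ (i ≡ j) → (i == j) ≡ false
==-false {i = i} {j} i≢j = trans (isYes≗does (i ≟ j)) (dec-false (i ≟ j) i≢j)

==-true : ∀ {m} {i j : Fin m} → (i == j) ≡ true → i ≡ j
==-true {i = i} {j} e with i ≟ j
... | yes p = p
... | no _ = ⊥-elim (true≢false (sym e))

Σl : ∀ {A : Set} → List A → (A → ℤ) → ℤ
Σl [] g = + 0
Σl (x ∷ xs) g = g x + Σl xs g

Σ-++ : ∀ {A : Set} (xs ys : List A) g → Σl (xs ++ ys) g ≡ Σl xs g + Σl ys g
Σ-++ [] ys g = sym (ℤP.+-identityˡ _)
Σ-++ (x ∷ xs) ys g rewrite Σ-++ xs ys g = sym (ℤP.+-assoc (g x) _ _)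

Σ-map : ∀ {A B : Set} (h : A → B) (xs : List A) g → Σl (map h xs) g ≡ Σl xs (g ∘ h)
Σ-map h [] g = refl
Σ-map h (x ∷ xs) g = cong (λ t → g (h x) + t) (Σ-map h xs g)

Σ-cong : ∀ {A : Set} (xs : List A) {g h : A → ℤ} → (∀ x → g x ≡ h x) → Σl xs g ≡ Σl xs h
Σ-cong [] e = refl
Σ-cong (x ∷ xs) e = cong₂ _+_ (e x) (Σ-cong xs e)

Σ-zero : ∀ {A : Set} (xs : List A) → Σl xs (λ _ → + 0) ≡ + 0
Σ-zero [] = refl
Σ-zero (x ∷ xs) = trans (ℤP.+-identityˡ _) (Σ-zero xs)

Σ-+ : ∀ {A : Set} (xs : List A) g h → Σl xs (λ x → g x + h x) ≡ Σl xs g + Σl xs h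
Σ-+ [] g h = refl
Σ-+ (x ∷ xs) g h rewrite Σ-+ xs g h = interchange (g x) (h x) (Σl xs g) (Σl xs h)
  where
  interchange : ∀ a b c d → (a + b) + (c + d) ≡ (a + c) + (b + d)
  interchange = solve-∀

Σ-- : ∀ {A : Set} (xs : List A) g h → Σl xs (λ x → g x - h x) ≡ Σl xs g - Σl xs h
Σ-- [] g h = refl
Σ-- (x ∷ xs) g h rewrite Σ-- xs g h = interchange (g x) (h x) (Σl xs g) (Σl xs h)
  where
  interchange : ∀ a b c d → (a - b) + (c - d) ≡ (a + c) - (b + d)
  interchange = solve-∀

Σ-* : ∀ {A : Set} (xs : List A) c g → Σl xs (λ x → c * g x) ≡ c * Σl xs g
Σ-* [] c g = sym (ℤP.*-zeroʳ c)
Σ-* (x ∷ xs) c g rewrite Σ-* xs c g = sym (ℤP.*-distribˡ-+ c (g x) _)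

sumUpTo-cong : ∀ m {g h : ℕ → ℤ} → (∀ k → g k ≡ h k) → sumUpTo m g ≡ sumUpTo m h
sumUpTo-cong zero e = refl
sumUpTo-cong (suc m) e = cong₂ _+_ (sumUpTo-cong m e) (e m)

sumUpTo-Σ : ∀ {A : Set} (xs : List A) m (h : ℕ → A → ℤ) →
  sumUpTo m (λ k → Σl xs (h k)) ≡ Σl xs (λ x → sumUpTo m (λ k → h k x))
sumUpTo-Σ xs zero h = sym (Σ-zero xs)
sumUpTo-Σ xs (suc m) h rewrite sumUpTo-Σ xs m h =
  sym (Σ-+ xs (λ x → sumUpTo m (λ k → h k x)) (h m))

ind : Bool → ℤ
ind true = + 1
ind false = + 0

count-Σ : ∀ {A : Set} (p : A → Bool) xs → + countᵇ p xs ≡ Σl xs (ind ∘ p)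
count-Σ p [] = refl
count-Σ p (x ∷ xs) with p x
... | true = cong (λ t → + 1 + t) (count-Σ p xs)
... | false = trans (count-Σ p xs) (sym (ℤP.+-identityˡ _))

Σ-subsets-suc : ∀ m (g : Vec Bool (suc m) → ℤ) →
  Σl (subsets (suc m)) g ≡ Σl (subsets m) (g ∘ (true ∷_)) + Σl (subsets m) (g ∘ (false ∷_))
Σ-subsets-suc m g = begin
  Σl (map (true ∷_) L ++ map (false ∷_) L) g         ≡⟨ Σ-++ (map (true ∷_) L) _ g ⟩
  Σl (map (true ∷_) L) g + Σl (map (false ∷_) L) g  ≡⟨ cong₂ _+_ (Σ-map _ L g) (Σ-map _ L g) ⟩
  Σl L (g ∘ (true ∷_)) + Σl L (g ∘ (false ∷_))       ∎
  where open ≡-Reasoning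
        L : List (Vec Bool m)
        L = subsets m

-- χ as a signed sum over cliques:  χ G = Σ_{cliques U ≠ ∅} (-1)^{|U|-1}

cliqueSign : ℕ → ℤ
cliqueSign zero = + 0
cliqueSign (suc m) = sgn m

-- Cliques of G have at most n G vertices, so the range k < n G in χ sees all of them.
card≤ : ∀ {m} (U : Vec Bool m) → card U ≤ m
card≤ [] = z≤n
card≤ (true ∷ U) = s≤s (card≤ U)
card≤ (false ∷ U) = m≤n⇒m≤1+n (card≤ U)

selectSign : ℕ → ℕ → ℤ
selectSign c m = sumUpTo m (λ k → sgn k * ind ⌊ c ≟ℕ suc k ⌋)

selectSign-< : ∀ c m → m < c → selectSign c m ≡ + 0
selectSign-< c zero _ = refl
selectSign-< c (suc m) m<c with c ≟ℕ suc m
... | yes refl = ⊥-elim (<-irrefl refl m<c)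
... | no _ rewrite selectSign-< c m (≤-trans (n≤1+n _) m<c) =
  trans (ℤP.+-identityˡ _) (ℤP.*-zeroʳ (sgn m))

selectSign-≤ : ∀ c m → c ≤ m → selectSign c m ≡ cliqueSign c
selectSign-≤ zero zero _ = refl
selectSign-≤ c (suc m) c≤m with c ≟ℕ suc m
... | yes refl rewrite selectSign-< (suc m) m ≤-refl =
  trans (ℤP.+-identityˡ _) (ℤP.*-identityʳ (sgn m))
... | no c≢m rewrite selectSign-≤ c m (≤-pred (≤∧≢⇒< c≤m c≢m)) =
  trans (cong (λ t → cliqueSign c + t) (ℤP.*-zeroʳ (sgn m))) (ℤP.+-identityʳ (cliqueSign c))

w : (G : Graph) → Vec Bool (n G) → ℤ
w G U = if isClique G U then cliqueSign (card U) else + 0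

Σk-contribution : ∀ (b : Bool) c m → c ≤ m →
  sumUpTo m (λ k → sgn k * ind (⌊ c ≟ℕ suc k ⌋ ∧ b)) ≡ (if b then cliqueSign c else + 0)
Σk-contribution true c m c≤m =
  trans (sumUpTo-cong m (λ k → cong (λ t → sgn k * ind t) (BP.∧-identityʳ _))) (selectSign-≤ c m c≤m)
Σk-contribution false c m _ =
  trans (sumUpTo-cong m (λ k → cong (λ t → sgn k * ind t) (BP.∧-zeroʳ _)))
        (trans (sumUpTo-cong m (λ k → ℤP.*-zeroʳ (sgn k))) (zeros m))
  where zeros : ∀ m → sumUpTo m (λ _ → + 0) ≡ + 0
        zeros zero = refl
        zeros (suc m) rewrite zeros m = refl

χ-cliqueSum : ∀ G → χ G ≡ Σl (subsets (n G)) (w G)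
χ-cliqueSum G = begin
  χ G
    ≡⟨ sumUpTo-cong (n G) (λ k → trans (cong (sgn k *_) (count-Σ _ L)) (sym (Σ-* L (sgn k) _))) ⟩
  sumUpTo (n G) (λ k → Σl L (λ U → sgn k * ind (⌊ card U ≟ℕ suc k ⌋ ∧ isClique G U)))
    ≡⟨ sumUpTo-Σ L (n G) _ ⟩
  Σl L (λ U → sumUpTo (n G) (λ k → sgn k * ind (⌊ card U ≟ℕ suc k ⌋ ∧ isClique G U)))
    ≡⟨ Σ-cong L (λ U → Σk-contribution (isClique G U) (card U) (n G) (card≤ U)) ⟩
  Σl L (w G) ∎
  where open ≡-Reasoning
        L : List (Vec Bool (n G))
        L = subsets (n G)

allᵇ-el : ∀ {A : Set} {m} (p : A → Bool) (f : Fin m → A) →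
  allᵇ p (tabulate f) ≡ true → ∀ i → p (f i) ≡ true
allᵇ-el {m = suc m} p f e zero = proj₁ (∧-el e)
allᵇ-el {m = suc m} p f e (suc i) = allᵇ-el p (f ∘ suc) (proj₂ (∧-el e)) i

allᵇ-in : ∀ {A : Set} {m} (p : A → Bool) (f : Fin m → A) →
  (∀ i → p (f i) ≡ true) → allᵇ p (tabulate f) ≡ true
allᵇ-in {m = zero} p f h = refl
allᵇ-in {m = suc m} p f h = ∧-in (h zero) (allᵇ-in p (f ∘ suc) (h ∘ suc))

implies-el : ∀ {b c} → not b ∨ c ≡ true → b ≡ true → c ≡ true
implies-el {true} {true} _ _ = refl

implies-in : ∀ {b c} → (b ≡ true → c ≡ true) → not b ∨ c ≡ true
implies-in {true} f = f refl
implies-in {false} f = refl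

Clique : (G : Graph) → Vec Bool (n G) → Set
Clique G U = (∀ i → lookup U i ≡ true → V G i ≡ true) ×
             (∀ i j → lookup U i ≡ true → lookup U j ≡ true → i ≢ j → E G i j ≡ true)

isClique→Clique : ∀ G U → isClique G U ≡ true → Clique G U
isClique→Clique G U e =
  (λ i ui → implies-el (allᵇ-el _ id (proj₁ (∧-el e)) i) ui) ,
  (λ i j ui uj i≢j → implies-el (allᵇ-el _ id (allᵇ-el _ id (proj₂ (∧-el e)) i) j)
                                (∧-in ui (∧-in uj (cong not (==-false i≢j)))))

Clique→isClique : ∀ G U → Clique G U → isClique G U ≡ true
Clique→isClique G U (inV , adj) = ∧-in
  (allᵇ-in _ id (λ i → implies-in (inV i)))
  (allᵇ-in _ id (λ i → allᵇ-in _ id (λ j → implies-in (λ h →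
     let (ui , h′) = ∧-el h ; (uj , i≠j) = ∧-el h′ in
     adj i j ui uj (λ { refl → true≢false (trans (sym i≠j) (cong not (==-refl i))) })))))

isClique-≡ : ∀ G H U U′ → (Clique G U → Clique H U′) → (Clique H U′ → Clique G U) →
  isClique G U ≡ isClique H U′
isClique-≡ G H U U′ to from = bool-ext
  (λ e → Clique→isClique H U′ (to (isClique→Clique G U e)))
  (λ e → Clique→isClique G U (from (isClique→Clique H U′ e)))

isClique-false : ∀ G U → ¬ Clique G U → isClique G U ≡ false
isClique-false G U ¬c = ≢true (λ e → ¬c (isClique→Clique G U e))

card0⇒empty : ∀ {m} (U : Vec Bool m) → card U ≡ 0 → ∀ i → lookup U i ≡ false
card0⇒empty (false ∷ U) e zero = refl
card0⇒empty (false ∷ U) e (suc i) = card0⇒empty U e i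

empty⇒card0 : ∀ {m} (U : Vec Bool m) → (∀ i → lookup U i ≡ false) → card U ≡ 0
empty⇒card0 [] h = refl
empty⇒card0 (true ∷ U) h with () ← h zero
empty⇒card0 (false ∷ U) h = empty⇒card0 U (h ∘ suc)

-- A graph without vertices has χ = 0: its only clique is ∅, of weight 0.
χ-noVertices : ∀ G → (∀ i → V G i ≡ false) → χ G ≡ + 0
χ-noVertices G noV = trans (χ-cliqueSum G) (trans (Σ-cong (subsets (n G)) weight0) (Σ-zero (subsets (n G))))
  where
  weight0 : ∀ U → w G U ≡ + 0
  weight0 U with isClique G U in e
  ... | false = refl
  ... | true rewrite empty⇒card0 U (λ i → ≢true (λ ui →
        true≢false (trans (sym (proj₁ (isClique→Clique G U e) i ui)) (noV i)))) = refl

-- Deleting a vertex:  χ G = χ (G ∖ v) + 1 - χ (S G v)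

_∖_ : (G : Graph) → Fin (n G) → Graph
G ∖ v = graph (n G) (λ i → V G i ∧ not (i == v)) (λ i j → E G i j ∧ not (i == v) ∧ not (j == v))

∖-vertex : ∀ G v {x} → V (G ∖ v) x ≡ true → (x == v) ≡ false
∖-vertex G v {x} p = not≡true (proj₂ (∧-el {V G x} p))

insert : ∀ {m} → Vec Bool m → Fin m → Vec Bool m
insert (x ∷ U) zero = true ∷ U
insert (x ∷ U) (suc v) = x ∷ insert U v

lookup-insert-≡ : ∀ {m} (U : Vec Bool m) v → lookup (insert U v) v ≡ true
lookup-insert-≡ (x ∷ U) zero = refl
lookup-insert-≡ (x ∷ U) (suc v) = lookup-insert-≡ U v

lookup-insert-≢ : ∀ {m} (U : Vec Bool m) v i → i ≢ v → lookup (insert U v) i ≡ lookup U i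
lookup-insert-≢ (x ∷ U) zero zero i≢v = ⊥-elim (i≢v refl)
lookup-insert-≢ (x ∷ U) zero (suc i) _ = refl
lookup-insert-≢ (x ∷ U) (suc v) zero _ = refl
lookup-insert-≢ (x ∷ U) (suc v) (suc i) i≢v = lookup-insert-≢ U v i (i≢v ∘ cong suc)

card-insert : ∀ {m} (U : Vec Bool m) v → lookup U v ≡ false → card (insert U v) ≡ suc (card U)
card-insert (false ∷ U) zero _ = refl
card-insert (true ∷ U) (suc v) e = cong suc (card-insert U v e)
card-insert (false ∷ U) (suc v) e = card-insert U v e

Σ-pairUp : ∀ m v (g : Vec Bool m → ℤ) →
  Σl (subsets m) g ≡ Σl (subsets m) (λ U → if lookup U v then + 0 else g U + g (insert U v))
Σ-pairUp (suc m) zero g = begin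
  Σl (subsets (suc m)) g                      ≡⟨ Σ-subsets-suc m g ⟩
  ΣT + ΣF                                     ≡⟨ ℤP.+-comm ΣT ΣF ⟩
  ΣF + ΣT                                     ≡⟨ sym (Σ-+ L _ _) ⟩
  Σl L (λ U → g (false ∷ U) + g (true ∷ U))   ≡⟨ sym (ℤP.+-identityˡ _) ⟩
  + 0 + Σl L (λ U → g (false ∷ U) + g (true ∷ U))
    ≡⟨ cong (λ t → t + Σl L (λ U → g (false ∷ U) + g (true ∷ U))) (sym (Σ-zero L)) ⟩
  Σl L (λ _ → + 0) + Σl L (λ U → g (false ∷ U) + g (true ∷ U))
    ≡⟨ sym (Σ-subsets-suc m _) ⟩
  Σl (subsets (suc m)) (λ U → if lookup U zero then + 0 else g U + g (insert U zero)) ∎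
  where open ≡-Reasoning
        L : List (Vec Bool m)
        L = subsets m
        ΣT ΣF : ℤ
        ΣT = Σl L (g ∘ (true ∷_))
        ΣF = Σl L (g ∘ (false ∷_))
Σ-pairUp (suc m) (suc v) g = begin
  Σl (subsets (suc m)) g                              ≡⟨ Σ-subsets-suc m g ⟩
  Σl L (g ∘ (true ∷_)) + Σl L (g ∘ (false ∷_))        ≡⟨ cong₂ _+_ (Σ-pairUp m v _) (Σ-pairUp m v _) ⟩
  Σl L (h ∘ (true ∷_)) + Σl L (h ∘ (false ∷_))        ≡⟨ sym (Σ-subsets-suc m h) ⟩
  Σl (subsets (suc m)) h ∎
  where open ≡-Reasoning
        L : List (Vec Bool m)
        L = subsets m
        h : Vec Bool (suc m) → ℤ
        h U = if lookup U (suc v) then + 0 else g U + g (insert U (suc v))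

δ₀ : ℕ → ℤ
δ₀ zero = + 1
δ₀ (suc _) = + 0

sgn≡δ₀-cliqueSign : ∀ k → sgn k ≡ δ₀ k - cliqueSign k
sgn≡δ₀-cliqueSign zero = refl
sgn≡δ₀-cliqueSign (suc k) = sym (ℤP.+-identityˡ _)

Σ-δ₀ : ∀ m → Σl (subsets m) (δ₀ ∘ card) ≡ + 1
Σ-δ₀ zero = refl
Σ-δ₀ (suc m) = trans (Σ-subsets-suc m (δ₀ ∘ card))
                     (cong₂ _+_ (Σ-zero (subsets m)) (Σ-δ₀ m))

empty-isClique : ∀ G U → card U ≡ 0 → isClique G U ≡ true
empty-isClique G U c = Clique→isClique G U ((λ i ui → absurd i ui) , λ i _ ui _ _ → absurd i ui)
  where absurd : ∀ {A : Set} i → lookup U i ≡ true → A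
        absurd i ui = ⊥-elim (true≢false (trans (sym ui) (card0⇒empty U c i)))

δ₀-clique : ∀ G U → (if isClique G U then δ₀ (card U) else + 0) ≡ δ₀ (card U)
δ₀-clique G U with card U in c
... | suc _ with isClique G U
...   | true = refl
...   | false = refl
δ₀-clique G U | zero rewrite empty-isClique G U c = refl

-- The deletion formula, for a vertex v of a simple graph G.  Each clique of G
-- either avoids v (a clique of G ∖ v) or is U ∪ {v} for a clique U of S(v).
module Deletion (G : Graph) (sG : IsSimple G) (v : Fin (n G)) (vv : V G v ≡ true) where
  open IsSimple sG using (irrefl; inV)

  private
    avoid : ∀ (U : Vec Bool (n G)) i → lookup U v ≡ false → lookup U i ≡ true → i ≢ v
    avoid U i uv ui refl = true≢false (trans (sym ui) uv)

    avoid′ : ∀ (U : Vec Bool (n G)) i → lookup U v ≡ false → lookup U i ≡ true → not (i == v) ≡ true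
    avoid′ U i uv ui = cong not (==-false (avoid U i uv ui))

  clique-∖ : ∀ U → lookup U v ≡ false → isClique G U ≡ isClique (G ∖ v) U
  clique-∖ U uv = isClique-≡ G (G ∖ v) U U
    (λ (verts , adj) → (λ i ui → ∧-in (verts i ui) (avoid′ U i uv ui)) ,
       λ i j ui uj i≢j → ∧-in (adj i j ui uj i≢j) (∧-in (avoid′ U i uv ui) (avoid′ U j uv uj)))
    (λ (verts , adj) → (λ i ui → proj₁ (∧-el (verts i ui))) ,
       λ i j ui uj i≢j → proj₁ (∧-el (adj i j ui uj i≢j)))

  clique-S : ∀ U → lookup U v ≡ false → isClique G (insert U v) ≡ isClique (S G v) U
  clique-S U uv = isClique-≡ G (S G v) (insert U v) U to from
    where
    U∪v : ∀ i → lookup U i ≡ true → lookup (insert U v) i ≡ true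
    U∪v i ui = trans (lookup-insert-≢ U v i (avoid U i uv ui)) ui
    v∈ : lookup (insert U v) v ≡ true
    v∈ = lookup-insert-≡ U v
    U∖v : ∀ i → i ≢ v → lookup (insert U v) i ≡ true → lookup U i ≡ true
    U∖v i i≢v e = trans (sym (lookup-insert-≢ U v i i≢v)) e
    to : Clique G (insert U v) → Clique (S G v) U
    to (_ , adj) = (λ i ui → adjV i ui) ,
        λ i j ui uj i≢j → ∧-in (adjV i ui) (∧-in (adjV j uj) (adj i j (U∪v i ui) (U∪v j uj) i≢j))
      where adjV : ∀ i → lookup U i ≡ true → E G v i ≡ true
            adjV i ui = adj v i v∈ (U∪v i ui) (λ e → avoid U i uv ui (sym e))
    from : Clique (S G v) U → Clique G (insert U v)
    from (inS , adjS) = inV′ , adj′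
      where
      inV′ : ∀ i → lookup (insert U v) i ≡ true → V G i ≡ true
      inV′ i e with i ≟ v
      ... | yes refl = vv
      ... | no i≢v = proj₂ (inV v i (inS i (U∖v i i≢v e)))
      adj′ : ∀ i j → lookup (insert U v) i ≡ true → lookup (insert U v) j ≡ true → i ≢ j → E G i j ≡ true
      adj′ i j ei ej i≢j with i ≟ v | j ≟ v
      ... | yes refl | yes refl = ⊥-elim (i≢j refl)
      ... | yes refl | no j≢v = inS j (U∖v j j≢v ej)
      ... | no i≢v | yes refl = trans (IsSimple.sym sG i v) (inS i (U∖v i i≢v ei))
      ... | no i≢v | no j≢v =
        proj₂ (∧-el {E G v j} (proj₂ (∧-el {E G v i} (adjS i j (U∖v i i≢v ei) (U∖v j j≢v ej) i≢j))))

  -- Weight of the complementary sets U ∌ v and U ∪ {v} together, in terms of G ∖ v and S(v):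
  -- |U ∪ {v}| = |U| + 1 and (-1)^|U| = [U = ∅] - cliqueSign |U|.
  private
    δS : Vec Bool (n G) → ℤ
    δS U = if isClique (S G v) U then δ₀ (card U) else + 0

  pairWeight : ∀ U → (if lookup U v then + 0 else w G U + w G (insert U v)) ≡
                     w (G ∖ v) U + δS U - w (S G v) U
  pairWeight U with lookup U v in uv
  ... | true rewrite isClique-false (G ∖ v) U (λ (verts , _) →
                       true≢false (trans (sym (verts v uv)) (cong₂ (λ x y → x ∧ not y) vv (==-refl v))))
                   | isClique-false (S G v) U (λ (verts , _) → true≢false (trans (sym (verts v uv)) (irrefl v)))
                   = refl
  ... | false rewrite clique-∖ U uv | clique-S U uv | card-insert U v uv
                with isClique (G ∖ v) U | isClique (S G v) U
  ...   | b | true = trans (cong (λ t → w′ + t) (sgn≡δ₀-cliqueSign (card U))) (sym (ℤP.+-assoc w′ _ _))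
    where w′ : ℤ
          w′ = if b then cliqueSign (card U) else + 0
  ...   | b | false = sym (ℤP.+-identityʳ _)

  -- Summing pairWeight: the δ₀ terms contribute 1 (from U = ∅).
  χ-delete : χ G ≡ χ (G ∖ v) + (+ 1 - χ (S G v))
  χ-delete = begin
    χ G                                                ≡⟨ χ-cliqueSum G ⟩
    Σl L (w G)                                         ≡⟨ Σ-pairUp (n G) v (w G) ⟩
    Σl L _                                             ≡⟨ Σ-cong L pairWeight ⟩
    Σl L (λ U → w (G ∖ v) U + δS U - w (S G v) U)      ≡⟨ Σ-- L _ _ ⟩
    Σl L (λ U → w (G ∖ v) U + δS U) - Σl L (w (S G v)) ≡⟨ cong (_- Σl L (w (S G v))) (Σ-+ L _ _) ⟩
    (Σl L (w (G ∖ v)) + Σl L δS) - Σl L (w (S G v))    ≡⟨ ℤP.+-assoc (Σl L (w (G ∖ v))) _ _ ⟩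
    Σl L (w (G ∖ v)) + (Σl L δS - Σl L (w (S G v)))
      ≡⟨ cong₃ (λ x y z → x + (y - z)) (sym (χ-cliqueSum (G ∖ v)))
               (trans (Σ-cong L (δ₀-clique (S G v))) (Σ-δ₀ (n G))) (sym (χ-cliqueSum (S G v))) ⟩
    χ (G ∖ v) + (+ 1 - χ (S G v)) ∎
    where open ≡-Reasoning
          L : List (Vec Bool (n G))
          L = subsets (n G)
          cong₃ : ∀ (f : ℤ → ℤ → ℤ → ℤ) {x x′ y y′ z z′} → x ≡ x′ → y ≡ y′ → z ≡ z′ → f x y z ≡ f x′ y′ z′
          cong₃ f refl refl refl = refl

open Deletion using (χ-delete)

simple-S : ∀ G → IsSimple G → ∀ x → IsSimple (S G x)
simple-S G sG x = record { sym = symmetric ; irrefl = irreflexive ; inV = endpoints }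
  where
  symmetric : ∀ i j → E G x i ∧ E G x j ∧ E G i j ≡ E G x j ∧ E G x i ∧ E G j i
  symmetric i j rewrite IsSimple.sym sG j i with E G x i | E G x j
  ... | true | true = refl
  ... | true | false = refl
  ... | false | true = refl
  ... | false | false = refl
  irreflexive : ∀ i → E G x i ∧ E G x i ∧ E G i i ≡ false
  irreflexive i rewrite IsSimple.irrefl sG i with E G x i
  ... | true = refl
  ... | false = refl
  endpoints : ∀ i j → E G x i ∧ E G x j ∧ E G i j ≡ true → (E G x i ≡ true) × (E G x j ≡ true)
  endpoints i j e = proj₁ (∧-el e) , proj₁ (∧-el (proj₂ (∧-el {E G x i} e)))

simple-∖ : ∀ G → IsSimple G → ∀ v → IsSimple (G ∖ v)
simple-∖ G sG v = record { sym = symmetric ; irrefl = irreflexive ; inV = endpoints }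
  where
  symmetric : ∀ i j → E G i j ∧ not (i == v) ∧ not (j == v) ≡ E G j i ∧ not (j == v) ∧ not (i == v)
  symmetric i j rewrite IsSimple.sym sG j i = cong (E G i j ∧_) (BP.∧-comm (not (i == v)) (not (j == v)))
  irreflexive : ∀ i → E G i i ∧ not (i == v) ∧ not (i == v) ≡ false
  irreflexive i rewrite IsSimple.irrefl sG i = refl
  endpoints : ∀ i j → E G i j ∧ not (i == v) ∧ not (j == v) ≡ true →
              (V G i ∧ not (i == v) ≡ true) × (V G j ∧ not (j == v) ≡ true)
  endpoints i j e =
    let (eij , rest) = ∧-el e ; (i≠v , j≠v) = ∧-el rest ; (vi , vj) = IsSimple.inV sG i j eij
    in ∧-in vi i≠v , ∧-in vj j≠v

-- Isomorphisms of graphs (on their vertex sets) preserve χ and 𝒳.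

-- φ is a bijection from the vertices of G onto those of H (with inverse ψ)
-- that preserves adjacency.
record Iso (G H : Graph) : Set where
  field
    φ : Fin (n G) → Fin (n H)
    ψ : (y : Fin (n H)) → V H y ≡ true → Fin (n G)
    Vφ : ∀ i → V G i ≡ true → V H (φ i) ≡ true
    Vψ : ∀ y p → V G (ψ y p) ≡ true
    φψ : ∀ y p → φ (ψ y p) ≡ y
    inj : ∀ i j → V G i ≡ true → V G j ≡ true → φ i ≡ φ j → i ≡ j
    Eφ : ∀ i j → V G i ≡ true → V G j ≡ true → E G i j ≡ E H (φ i) (φ j)

module _ {G H : Graph} (I : Iso G H) (sG : IsSimple G) (sH : IsSimple H) where
  open Iso I

  iso-S : ∀ x → V G x ≡ true → Iso (S G x) (S H (φ x))
  iso-S x vx = record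
    { φ = φ
    ; ψ = λ y p → ψ y (vH p)
    ; Vφ = λ i p → trans (sym (Eφ x i vx (vG p))) p
    ; Vψ = λ y p → trans (Eφ x (ψ y (vH p)) vx (Vψ y (vH p))) (trans (cong (E H (φ x)) (φψ y (vH p))) p)
    ; φψ = λ y p → φψ y (vH p)
    ; inj = λ i j pi pj → inj i j (vG pi) (vG pj)
    ; Eφ = λ i j pi pj → cong₂ _∧_ (Eφ x i vx (vG pi)) (cong₂ _∧_ (Eφ x j vx (vG pj)) (Eφ i j (vG pi) (vG pj)))
    }
    where
    vG : ∀ {i} → E G x i ≡ true → V G i ≡ true
    vG p = proj₂ (IsSimple.inV sG x _ p)
    vH : ∀ {y} → E H (φ x) y ≡ true → V H y ≡ true
    vH p = proj₂ (IsSimple.inV sH (φ x) _ p)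

  φ-== : ∀ v i → V G v ≡ true → V G i ≡ true → (i == v) ≡ (φ i == φ v)
  φ-== v i vv vi = bool-ext (λ e → trans (cong (λ t → φ t == φ v) (==-true e)) (==-refl (φ v)))
                            (λ e → trans (cong (_== v) (inj i v vi vv (==-true e))) (==-refl v))

  iso-∖ : ∀ v → V G v ≡ true → Iso (G ∖ v) (H ∖ φ v)
  iso-∖ v vv = record
    { φ = φ
    ; ψ = λ y p → ψ y (vH p)
    ; Vφ = λ i p → ∧-in (Vφ i (vG p)) (trans (cong not (sym (φ-== v i vv (vG p)))) (proj₂ (∧-el p)))
    ; Vψ = λ y p → let q = vH p in
         ∧-in (Vψ y q) (trans (cong not (trans (φ-== v (ψ y q) vv (Vψ y q)) (cong (_== φ v) (φψ y q))))
                              (proj₂ (∧-el p)))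
    ; φψ = λ y p → φψ y (vH p)
    ; inj = λ i j pi pj → inj i j (vG pi) (vG pj)
    ; Eφ = λ i j pi pj → cong₂ _∧_ (Eφ i j (vG pi) (vG pj))
                                   (cong₂ _∧_ (cong not (φ-== v i vv (vG pi))) (cong not (φ-== v j vv (vG pj))))
    }
    where
    vG : ∀ {i} → V G i ∧ not (i == v) ≡ true → V G i ≡ true
    vG p = proj₁ (∧-el p)
    vH : ∀ {y} → V H y ∧ not (y == φ v) ≡ true → V H y ≡ true
    vH p = proj₁ (∧-el p)

bit : Bool → ℕ
bit true = 1
bit false = 0

vertexCount : ∀ {m} → (Fin m → Bool) → ℕ
vertexCount {zero} p = 0
vertexCount {suc m} p = bit (p zero) +ℕ vertexCount (p ∘ suc)

Subset : ∀ {m} → (Fin m → Bool) → (Fin m → Bool) → Set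
Subset p q = ∀ i → p i ≡ true → q i ≡ true

bit-mono : ∀ {a b} → (a ≡ true → b ≡ true) → bit a ≤ bit b
bit-mono {true} f rewrite f refl = ≤-refl
bit-mono {false} f = z≤n

vertexCount-mono : ∀ {m} (p q : Fin m → Bool) → Subset p q → vertexCount p ≤ vertexCount q
vertexCount-mono {zero} p q p⊆q = z≤n
vertexCount-mono {suc m} p q p⊆q =
  +-mono-≤ (bit-mono (p⊆q zero)) (vertexCount-mono (p ∘ suc) (q ∘ suc) (p⊆q ∘ suc))

vertexCount-< : ∀ {m} (p q : Fin m → Bool) v → Subset p q → p v ≡ false → q v ≡ true →
  vertexCount p < vertexCount q
vertexCount-< {suc m} p q zero p⊆q pv qv rewrite pv | qv =
  s≤s (vertexCount-mono (p ∘ suc) (q ∘ suc) (p⊆q ∘ suc))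
vertexCount-< {suc m} p q (suc v) p⊆q pv qv =
  +-mono-≤-< (bit-mono (p⊆q zero)) (vertexCount-< (p ∘ suc) (q ∘ suc) v (p⊆q ∘ suc) pv qv)

-- Induction on the number of vertices, peeling off one vertex with χ-delete.
χ-iso-bounded : ∀ N {G H} → IsSimple G → IsSimple H → Iso G H → vertexCount (V G) ≤ N → χ G ≡ χ H
χ-iso-bounded N {G} {H} sG sH I bound with any? (λ i → V G i ≟ᵇ true)
... | no noVertex = trans (χ-noVertices G (λ i → ≢true (λ vi → noVertex (i , vi))))
                          (sym (χ-noVertices H (λ y → ≢true (λ p → noVertex (Iso.ψ I y p , Iso.Vψ I y p)))))
... | yes (v , vv) with N
...   | zero = ⊥-elim (n≮0 (≤-trans (vertexCount-< (λ _ → false) (V G) v (λ _ ()) refl vv) bound))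
...   | suc N′ = begin
  χ G                                          ≡⟨ χ-delete G sG v vv ⟩
  χ (G ∖ v) + (+ 1 - χ (S G v))
    ≡⟨ cong₂ (λ x y → x + (+ 1 - y))
             (χ-iso-bounded N′ (simple-∖ G sG v) (simple-∖ H sH (φ v)) (iso-∖ I sG sH v vv) smaller-∖)
             (χ-iso-bounded N′ (simple-S G sG v) (simple-S H sH (φ v)) (iso-S I sG sH v vv) smaller-S) ⟩
  χ (H ∖ φ v) + (+ 1 - χ (S H (φ v)))          ≡⟨ sym (χ-delete H sH (φ v) (Iso.Vφ I v vv)) ⟩
  χ H ∎
  where
  open ≡-Reasoning
  open Iso I using (φ)
  smaller-∖ : vertexCount (V (G ∖ v)) ≤ N′
  smaller-∖ = ≤-pred (≤-trans (vertexCount-< _ (V G) v (λ i p → proj₁ (∧-el p))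
                                 (cong₂ (λ x y → x ∧ not y) vv (==-refl v)) vv) bound)
  smaller-S : vertexCount (V (S G v)) ≤ N′
  smaller-S = ≤-pred (≤-trans (vertexCount-< _ (V G) v (λ i p → proj₂ (IsSimple.inV sG v i p))
                                 (IsSimple.irrefl sG v) vv) bound)

χ-iso : ∀ {G H} → IsSimple G → IsSimple H → Iso G H → χ G ≡ χ H
χ-iso {G} sG sH I = χ-iso-bounded (vertexCount (V G)) sG sH I ≤-refl

𝒳-iso : ∀ k {G H} → IsSimple G → IsSimple H → Iso G H → 𝒳 k G → 𝒳 k H
𝒳-iso zero sG sH I empty y = ≢true (λ p → true≢false (trans (sym (Iso.Vψ I y p)) (empty (Iso.ψ I y p))))
𝒳-iso (suc d) {G} {H} sG sH I (χG , spheres) = trans (sym (χ-iso sG sH I)) χG , spheres′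
  where
  open Iso I
  spheres′ : ∀ y → V H y ≡ true → 𝒳 d (S H y)
  spheres′ y p = subst (λ z → 𝒳 d (S H z)) (φψ y p)
    (𝒳-iso d (simple-S G sG (ψ y p)) (simple-S H sH (φ (ψ y p))) (iso-S I sG sH (ψ y p) (Vψ y p))
           (spheres (ψ y p) (Vψ y p)))

idIso : ∀ {m} (V₁ V₂ : Fin m → Bool) (E₁ E₂ : Fin m → Fin m → Bool) →
  (∀ i → V₁ i ≡ V₂ i) → (∀ i j → V₁ i ≡ true → V₁ j ≡ true → E₁ i j ≡ E₂ i j) →
  Iso (graph m V₁ E₁) (graph m V₂ E₂)
idIso V₁ V₂ E₁ E₂ sameV sameE = record
  { φ = id ; ψ = λ y _ → y
  ; Vφ = λ i p → trans (sym (sameV i)) p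
  ; Vψ = λ y p → trans (sameV y) p
  ; φψ = λ _ _ → refl
  ; inj = λ _ _ _ _ e → e
  ; Eφ = sameE }

shiftIso : ∀ (H : Graph) (VK : Fin (suc (n H)) → Bool) (EK : Fin (suc (n H)) → Fin (suc (n H)) → Bool) →
  VK zero ≡ false → (∀ y → VK (suc y) ≡ V H y) →
  (∀ i j → V H i ≡ true → V H j ≡ true → E H i j ≡ EK (suc i) (suc j)) →
  Iso H (graph (suc (n H)) VK EK)
shiftIso H VK EK v0 vs sameE = record
  { φ = suc ; ψ = ψ
  ; Vφ = λ i p → trans (vs i) p
  ; Vψ = Vψ
  ; φψ = φψ
  ; inj = λ { i .i _ _ refl → refl }
  ; Eφ = sameE }
  where
  ψ : (y : Fin (suc (n H))) → VK y ≡ true → Fin (n H)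
  ψ zero p = ⊥-elim (true≢false (trans (sym p) v0))
  ψ (suc y) _ = y
  Vψ : ∀ y p → V H (ψ y p) ≡ true
  Vψ zero p = ⊥-elim (true≢false (trans (sym p) v0))
  Vψ (suc y) p = trans (sym (vs y)) p
  φψ : ∀ y p → suc (ψ y p) ≡ y
  φψ zero p = ⊥-elim (true≢false (trans (sym p) v0))
  φψ (suc y) _ = refl

isoTrans : ∀ {G H K} → Iso G H → Iso H K → Iso G K
isoTrans I J = record
  { φ = λ i → J.φ (I.φ i)
  ; ψ = λ y p → I.ψ (J.ψ y p) (J.Vψ y p)
  ; Vφ = λ i p → J.Vφ (I.φ i) (I.Vφ i p)
  ; Vψ = λ y p → I.Vψ (J.ψ y p) (J.Vψ y p)
  ; φψ = λ y p → trans (cong J.φ (I.φψ (J.ψ y p) (J.Vψ y p))) (J.φψ y p)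
  ; inj = λ i j pi pj e → I.inj i j pi pj (J.inj (I.φ i) (I.φ j) (I.Vφ i pi) (I.Vφ j pj) e)
  ; Eφ = λ i j pi pj → trans (I.Eφ i j pi pj) (J.Eφ (I.φ i) (I.φ j) (I.Vφ i pi) (I.Vφ j pj))
  }
  where module I = Iso I
        module J = Iso J

shift₂Iso : ∀ (H : Graph) (VK : Fin (suc (suc (n H))) → Bool)
  (EK : Fin (suc (suc (n H))) → Fin (suc (suc (n H))) → Bool) →
  VK zero ≡ false → VK (suc zero) ≡ false → (∀ y → VK (suc (suc y)) ≡ V H y) →
  (∀ i j → V H i ≡ true → V H j ≡ true → E H i j ≡ EK (suc (suc i)) (suc (suc j))) →
  Iso H (graph (suc (suc (n H))) VK EK)
shift₂Iso H VK EK v0 v1 vs sameE =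
  isoTrans (shiftIso H (λ y → VK (suc y)) (λ i j → EK (suc i) (suc j)) v1 vs sameE)
           (shiftIso (graph (suc (n H)) (λ y → VK (suc y)) (λ i j → EK (suc i) (suc j))) VK EK
                     v0 (λ _ → refl) (λ _ _ _ _ → refl))

-- Cones and suspensions

-- If deleting v and taking the unit sphere of v give graphs with equal χ
-- (e.g. v is a cone apex), then χ G = 1.
χ-cone : ∀ G → IsSimple G → ∀ v → V G v ≡ true → χ (G ∖ v) ≡ χ (S G v) → χ G ≡ + 1
χ-cone G sG v vv same = begin
  χ G                            ≡⟨ χ-delete G sG v vv ⟩
  χ (G ∖ v) + (+ 1 - χ (S G v))  ≡⟨ cong (λ x → x + (+ 1 - χ (S G v))) same ⟩
  χ (S G v) + (+ 1 - χ (S G v))  ≡⟨ x+[1-x]≡1 (χ (S G v)) ⟩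
  + 1 ∎
  where open ≡-Reasoning
        x+[1-x]≡1 : ∀ x → x + (+ 1 - x) ≡ + 1
        x+[1-x]≡1 = solve-∀

-- The suspension of H: two new non-adjacent poles (indices 0 and 1) joined to every vertex of H.
suspV : (H : Graph) → Fin (suc (suc (n H))) → Bool
suspV H zero = true
suspV H (suc zero) = true
suspV H (suc (suc i)) = V H i

suspE : (H : Graph) → Fin (suc (suc (n H))) → Fin (suc (suc (n H))) → Bool
suspE H zero (suc (suc i)) = V H i
suspE H (suc zero) (suc (suc i)) = V H i
suspE H (suc (suc i)) zero = V H i
suspE H (suc (suc i)) (suc zero) = V H i
suspE H (suc (suc i)) (suc (suc j)) = E H i j
suspE H _ _ = false

Susp : Graph → Graph
Susp H = graph (suc (suc (n H))) (suspV H) (suspE H)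

simple-Susp : ∀ H → IsSimple H → IsSimple (Susp H)
simple-Susp H sH = record { sym = symmetric ; irrefl = irreflexive ; inV = endpoints }
  where
  symmetric : ∀ i j → suspE H i j ≡ suspE H j i
  symmetric zero zero = refl
  symmetric zero (suc zero) = refl
  symmetric zero (suc (suc j)) = refl
  symmetric (suc zero) zero = refl
  symmetric (suc zero) (suc zero) = refl
  symmetric (suc zero) (suc (suc j)) = refl
  symmetric (suc (suc i)) zero = refl
  symmetric (suc (suc i)) (suc zero) = refl
  symmetric (suc (suc i)) (suc (suc j)) = IsSimple.sym sH i j
  irreflexive : ∀ i → suspE H i i ≡ false
  irreflexive zero = refl
  irreflexive (suc zero) = refl
  irreflexive (suc (suc i)) = IsSimple.irrefl sH i
  endpoints : ∀ i j → suspE H i j ≡ true → (suspV H i ≡ true) × (suspV H j ≡ true)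
  endpoints zero (suc (suc j)) e = refl , e
  endpoints (suc zero) (suc (suc j)) e = refl , e
  endpoints (suc (suc i)) zero e = e , refl
  endpoints (suc (suc i)) (suc zero) e = e , refl
  endpoints (suc (suc i)) (suc (suc j)) e = IsSimple.inV sH i j e

pole₀-sphere : ∀ H → Iso H (S (Susp H) zero)
pole₀-sphere H = shift₂Iso H _ _ refl refl (λ _ → refl) (λ i j vi vj → sym (cong₂ (λ x y → x ∧ y ∧ E H i j) vi vj))

pole₁-sphere : ∀ H → Iso H (S (Susp H) (suc zero))
pole₁-sphere H = shift₂Iso H _ _ refl refl (λ _ → refl) (λ i j vi vj → sym (cong₂ (λ x y → x ∧ y ∧ E H i j) vi vj))

equator-sphere : ∀ H → IsSimple H → ∀ z → V H z ≡ true → Iso (Susp (S H z)) (S (Susp H) (suc (suc z)))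
equator-sphere H sH z vz = idIso _ _ _ _ sameV sameE
  where
  sameV : ∀ i → suspV (S H z) i ≡ suspE H (suc (suc z)) i
  sameV zero = sym vz
  sameV (suc zero) = sym vz
  sameV (suc (suc i)) = refl
  nbr : ∀ {w} → E H z w ≡ true → V H w ≡ true
  nbr p = proj₂ (IsSimple.inV sH z _ p)
  sameE : ∀ i j → suspV (S H z) i ≡ true → suspV (S H z) j ≡ true →
          suspE (S H z) i j ≡ suspE H (suc (suc z)) i ∧ suspE H (suc (suc z)) j ∧ suspE H i j
  sameE zero zero _ _ rewrite vz = refl
  sameE zero (suc zero) _ _ rewrite vz = refl
  sameE zero (suc (suc j)) _ pj rewrite vz | pj | nbr pj = refl
  sameE (suc zero) zero _ _ rewrite vz = refl
  sameE (suc zero) (suc zero) _ _ rewrite vz = refl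
  sameE (suc zero) (suc (suc j)) _ pj rewrite vz | pj | nbr pj = refl
  sameE (suc (suc i)) zero pi _ rewrite vz | pi | nbr pi = refl
  sameE (suc (suc i)) (suc zero) pi _ rewrite vz | pi | nbr pi = refl
  sameE (suc (suc i)) (suc (suc j)) _ _ = refl

-- χ (Susp H) = 2 - χ H: delete pole 0; what remains is a cone with apex pole 1.
χ-Susp : ∀ H → IsSimple H → χ (Susp H) ≡ + 2 - χ H
χ-Susp H sH = begin
  χ K                                 ≡⟨ χ-delete K sK zero refl ⟩
  χ (K ∖ zero) + (+ 1 - χ (S K zero))
    ≡⟨ cong₂ (λ x y → x + (+ 1 - y)) χ-cone₁ (sym (χ-iso sH (simple-S K sK zero) (pole₀-sphere H))) ⟩
  + 1 + (+ 1 - χ H)                   ≡⟨ 1+[1-x]≡2-x (χ H) ⟩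
  + 2 - χ H ∎
  where
  open ≡-Reasoning
  K : Graph
  K = Susp H
  sK : IsSimple K
  sK = simple-Susp H sH
  D : Graph
  D = K ∖ zero
  sD : IsSimple D
  sD = simple-∖ K sK zero
  base : Iso H (D ∖ suc zero)
  base = shift₂Iso H _ _ refl refl (λ _ → trans (BP.∧-identityʳ _) (BP.∧-identityʳ _))
           (λ i j _ _ → sym (trans (BP.∧-identityʳ _) (trans (cong (E H i j ∧_) (BP.∧-identityʳ true)) (BP.∧-identityʳ _))))
  apexSphere : Iso H (S D (suc zero))
  apexSphere = shift₂Iso H _ _ refl refl (λ _ → BP.∧-identityʳ _)
    (λ i j vi vj → sym (trans (cong₂ (λ x y → (x ∧ true ∧ true) ∧ (y ∧ true ∧ true) ∧ (E H i j ∧ true ∧ true)) vi vj)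
                              (BP.∧-identityʳ _)))
  χ-cone₁ : χ D ≡ + 1
  χ-cone₁ = χ-cone D sD (suc zero) refl
    (trans (sym (χ-iso sH (simple-∖ D sD (suc zero)) base)) (χ-iso sH (simple-S D sD (suc zero)) apexSphere))
  1+[1-x]≡2-x : ∀ x → + 1 + (+ 1 - x) ≡ + 2 - x
  1+[1-x]≡2-x = solve-∀

χ𝒳 : ℕ → ℤ
χ𝒳 zero = + 0
χ𝒳 (suc d) = + 1 + sgn d

χ-𝒳 : ∀ k G → 𝒳 k G → χ G ≡ χ𝒳 k
χ-𝒳 zero G empty = χ-noVertices G empty
χ-𝒳 (suc k) G (χG , _) = χG

2-χ𝒳 : ∀ k → + 2 - χ𝒳 k ≡ χ𝒳 (suc k)
2-χ𝒳 zero = refl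
2-χ𝒳 (suc k) = 2-[1+x]≡1-x (sgn k)
  where 2-[1+x]≡1-x : ∀ x → + 2 - (+ 1 + x) ≡ + 1 + - x
        2-[1+x]≡1-x = solve-∀

-- Suspension raises the dimension by one:  H ∈ 𝒳_{d} ⇒ Susp H ∈ 𝒳_{d+1}.
-- Mutually with the spheres of the equator, which are suspensions of spheres of H.
susp-𝒳 : ∀ k H → IsSimple H → 𝒳 k H → 𝒳 (suc k) (Susp H)
equator-𝒳 : ∀ k H → IsSimple H → 𝒳 k H → ∀ z → V H z ≡ true → 𝒳 k (S (Susp H) (suc (suc z)))

susp-𝒳 k H sH X = trans (χ-Susp H sH) (trans (cong (λ t → + 2 - t) (χ-𝒳 k H X)) (2-χ𝒳 k)) , spheres
  where
  sK : IsSimple (Susp H)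
  sK = simple-Susp H sH
  spheres : ∀ x → suspV H x ≡ true → 𝒳 k (S (Susp H) x)
  spheres zero _ = 𝒳-iso k sH (simple-S _ sK zero) (pole₀-sphere H) X
  spheres (suc zero) _ = 𝒳-iso k sH (simple-S _ sK (suc zero)) (pole₁-sphere H) X
  spheres (suc (suc z)) vz = equator-𝒳 k H sH X z vz

equator-𝒳 zero H sH empty z vz = ⊥-elim (true≢false (trans (sym vz) (empty z)))
equator-𝒳 (suc k) H sH (_ , spheres) z vz =
  𝒳-iso (suc k) (simple-Susp _ (simple-S H sH z)) (simple-S _ (simple-Susp H sH) (suc (suc z)))
        (equator-sphere H sH z vz) (susp-𝒳 k (S H z) (simple-S H sH z) (spheres z vz))

-- Edge refinement

suc-== : ∀ {m} (i j : Fin m) → (Fin.suc i == suc j) ≡ (i == j)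
suc-== i j with i ≟ j
... | yes _ = refl
... | no _ = refl

≢-suc : ∀ {m} {x y : Fin m} → x ≢ y → Fin.suc x ≢ suc y
≢-suc x≢y = x≢y ∘ suc-injective

refine-swap : ∀ G a b → Iso (refine G b a) (refine G a b)
refine-swap G a b = idIso _ _ _ _ sameV sameE
  where
  sameV : ∀ u → V (refine G b a) u ≡ V (refine G a b) u
  sameV zero = refl
  sameV (suc u) = refl
  sameE : ∀ u v → V (refine G b a) u ≡ true → V (refine G b a) v ≡ true →
          E (refine G b a) u v ≡ E (refine G a b) u v
  sameE zero zero _ _ = refl
  sameE zero (suc z) _ _ = cong₂ _∨_ (BP.∨-comm (z == b) (z == a)) (BP.∧-comm (E G b z) (E G a z))
  sameE (suc z) zero _ _ = cong₂ _∨_ (BP.∨-comm (z == b) (z == a)) (BP.∧-comm (E G b z) (E G a z))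
  sameE (suc i) (suc j) _ _ = cong (λ t → E G i j ∧ not t) (BP.∨-comm ((i == b) ∧ (j == a)) ((i == a) ∧ (j == b)))

module Refinement (G : Graph) (sG : IsSimple G) (a b : Fin (n G)) (eab : E G a b ≡ true) where
  open IsSimple sG using (irrefl; inV)

  G′ : Graph
  G′ = refine G a b

  va : V G a ≡ true
  va = proj₁ (inV a b eab)

  vb : V G b ≡ true
  vb = proj₂ (inV a b eab)

  eba : E G b a ≡ true
  eba = trans (IsSimple.sym sG b a) eab

  adj⇒≢ : ∀ {x y} → E G x y ≡ true → y ≢ x
  adj⇒≢ {x} e refl = true≢false (trans (sym e) (irrefl x))

  adj⇒≠ : ∀ {x y} → E G x y ≡ true → (y == x) ≡ false
  adj⇒≠ e = ==-false (adj⇒≢ e)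

  a≢b : a ≢ b
  a≢b = adj⇒≢ eba

  a==b : (a == b) ≡ false
  a==b = adj⇒≠ eba

  b==a : (b == a) ≡ false
  b==a = adj⇒≠ eab

  newNbr⇒V : ∀ z → E G′ zero (suc z) ≡ true → V G z ≡ true
  newNbr⇒V z e with z ≟ a | z ≟ b
  ... | yes refl | _ = va
  ... | no _ | yes refl = vb
  ... | no _ | no _ = proj₂ (inV a z (proj₁ (∧-el e)))

  simple-G′ : IsSimple G′
  simple-G′ = record { sym = symmetric ; irrefl = irreflexive ; inV = endpoints }
    where
    symmetric : ∀ i j → E G′ i j ≡ E G′ j i
    symmetric zero zero = refl
    symmetric zero (suc j) = refl
    symmetric (suc i) zero = refl
    symmetric (suc i) (suc j)
      rewrite IsSimple.sym sG j i | BP.∧-comm (j == a) (i == b) | BP.∧-comm (j == b) (i == a) =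
      cong (λ t → E G i j ∧ not t) (BP.∨-comm ((i == a) ∧ (j == b)) ((i == b) ∧ (j == a)))
    irreflexive : ∀ i → E G′ i i ≡ false
    irreflexive zero = refl
    irreflexive (suc i) rewrite irrefl i = refl
    endpoints : ∀ i j → E G′ i j ≡ true → (V G′ i ≡ true) × (V G′ j ≡ true)
    endpoints zero (suc j) e = refl , newNbr⇒V j e
    endpoints (suc i) zero e = newNbr⇒V i e , refl
    endpoints (suc i) (suc j) e = inV i j (proj₁ (∧-el e))

  -- The unit sphere of a in G′: b is replaced by the new vertex, nothing else changes.
  sphere-a : Iso (S G a) (S G′ (suc a))
  sphere-a = record { φ = φ ; ψ = ψ ; Vφ = Vφ ; Vψ = Vψ ; φψ = φψ ; inj = inj ; Eφ = Eφ }
    where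
    φ : Fin (n G) → Fin (suc (n G))
    φ z = if z == b then zero else suc z
    ψ : (y : Fin (suc (n G))) → V (S G′ (suc a)) y ≡ true → Fin (n G)
    ψ zero _ = b
    ψ (suc z) _ = z
    Vφ : ∀ i → E G a i ≡ true → V (S G′ (suc a)) (φ i) ≡ true
    Vφ i ai with i ≟ b
    ... | yes refl rewrite ==-refl a = refl
    ... | no i≢b rewrite ==-refl a | a==b | ai | ==-false i≢b = refl
    Vψ : ∀ y p → E G a (ψ y p) ≡ true
    Vψ zero _ = eab
    Vψ (suc z) p = proj₁ (∧-el p)
    φψ : ∀ y p → φ (ψ y p) ≡ y
    φψ zero _ rewrite ==-refl b = refl
    φψ (suc z) p with z ≟ b
    ... | yes refl rewrite ==-refl a | eab = ⊥-elim (true≢false (sym p))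
    ... | no _ = refl
    inj : ∀ i j → E G a i ≡ true → E G a j ≡ true → φ i ≡ φ j → i ≡ j
    inj i j _ _ e with i ≟ b | j ≟ b
    ... | yes refl | yes refl = refl
    ... | yes _ | no _ = ⊥-elim (0≢1+n e)
    ... | no _ | yes _ = ⊥-elim (0≢1+n (sym e))
    ... | no _ | no _ = suc-injective e
    Eφ : ∀ i j → E G a i ≡ true → E G a j ≡ true →
         E G a i ∧ E G a j ∧ E G i j ≡ E G′ (suc a) (φ i) ∧ E G′ (suc a) (φ j) ∧ E G′ (φ i) (φ j)
    Eφ i j ai aj with i ≟ b | j ≟ b
    ... | yes refl | yes refl rewrite eab | irrefl b | ==-refl a = refl
    ... | yes refl | no j≢b rewrite eab | aj | adj⇒≠ aj | ==-refl a | a==b | ==-false j≢b = refl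
    ... | no i≢b | yes refl
      rewrite eab | ai | adj⇒≠ ai | ==-refl a | a==b | IsSimple.sym sG i b | ==-false i≢b = refl
    ... | no i≢b | no j≢b
      rewrite ai | aj | adj⇒≠ ai | adj⇒≠ aj | ==-refl a | a==b | ==-false i≢b | ==-false j≢b =
      sym (BP.∧-identityʳ _)

  delete-a-new : Iso (G ∖ a) ((G′ ∖ suc a) ∖ zero)
  delete-a-new = shiftIso (G ∖ a) _ _ refl sameV sameE
    where
    sameV : ∀ y → (V G y ∧ not (suc y == suc a)) ∧ true ≡ V G y ∧ not (y == a)
    sameV y rewrite suc-== y a = BP.∧-identityʳ _
    sameE : ∀ i j → V G i ∧ not (i == a) ≡ true → V G j ∧ not (j == a) ≡ true →
            E (G ∖ a) i j ≡ E ((G′ ∖ suc a) ∖ zero) (suc i) (suc j)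
    sameE i j vi vj rewrite suc-== i a | suc-== j a | ∖-vertex G a vi | ∖-vertex G a vj
                          | BP.∧-zeroʳ (i == b) | BP.∧-identityʳ (E G i j) =
      sym (trans (BP.∧-identityʳ _) (BP.∧-identityʳ _))

  W : Graph
  W = S (S G a) b
  sW : IsSimple W
  sW = simple-S (S G a) (simple-S G sG a) b

  Common : Fin (n G) → Set
  Common i = (E G a i ≡ true) × (E G b i ≡ true)

  common : ∀ {i} → V W i ≡ true → Common i
  common {i} p = let (_ , rest) = ∧-el {E G a b} p in ∧-el rest

  -- In G′ ∖ a, the sphere of the new vertex is a cone with apex b over W.
  K : Graph
  K = S (G′ ∖ suc a) zero
  sK : IsSimple K
  sK = simple-S (G′ ∖ suc a) (simple-∖ G′ simple-G′ (suc a)) zero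

  apex : V K (suc b) ≡ true
  apex rewrite suc-== b a | b==a | ==-refl b = refl

  cone-base : Iso W (K ∖ suc b)
  cone-base = shiftIso W _ _ refl sameV sameE
    where
    sameV : ∀ y → V (K ∖ suc b) (suc y) ≡ V W y
    sameV y rewrite suc-== y a | suc-== y b | eab with y ≟ a | y ≟ b
    ... | yes refl | _ rewrite irrefl a = refl
    ... | no _ | yes refl rewrite irrefl b = sym (BP.∧-zeroʳ _)
    ... | no _ | no _ with E G a y | E G b y
    ...   | true | true = refl
    ...   | true | false = refl
    ...   | false | _ = refl
    sameE : ∀ i j → V W i ≡ true → V W j ≡ true → E W i j ≡ E (K ∖ suc b) (suc i) (suc j)
    sameE i j vi vj = edges (common vi) (common vj)
      where
      edges : Common i → Common j → E W i j ≡ E (K ∖ suc b) (suc i) (suc j)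
      edges (ai , bi) (aj , bj)
        rewrite suc-== i a | suc-== i b | suc-== j a | suc-== j b
              | eab | ai | bi | aj | bj | adj⇒≠ ai | adj⇒≠ bi | adj⇒≠ aj | adj⇒≠ bj
        with E G i j
      ... | true = refl
      ... | false = refl

  cone-sphere : Iso W (S K (suc b))
  cone-sphere = shiftIso W _ _ notNew sameV sameE
    where
    sb==sa : (Fin.suc b == suc a) ≡ false
    sb==sa = ==-false (≢-suc (a≢b ∘ sym))
    notNew : V (S K (suc b)) zero ≡ false
    notNew rewrite sb==sa | b==a | ==-refl b = refl
    sameV : ∀ y → V (S K (suc b)) (suc y) ≡ V W y
    sameV y rewrite sb==sa | b==a | ==-refl b | eab | suc-== y a with y ≟ a | y ≟ b
    ... | yes refl | _ rewrite irrefl a = refl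
    ... | no _ | yes refl rewrite irrefl b = sym (BP.∧-zeroʳ _)
    ... | no _ | no _ with E G a y | E G b y
    ...   | true | true = refl
    ...   | true | false = refl
    ...   | false | _ = refl
    sameE : ∀ i j → V W i ≡ true → V W j ≡ true → E W i j ≡ E (S K (suc b)) (suc i) (suc j)
    sameE i j vi vj = edges (common vi) (common vj)
      where
      edges : Common i → Common j → E W i j ≡ E (S K (suc b)) (suc i) (suc j)
      edges (ai , bi) (aj , bj)
        rewrite sb==sa | b==a | ==-refl b | eab | ai | bi | aj | bj
              | adj⇒≠ ai | adj⇒≠ bi | adj⇒≠ aj | adj⇒≠ bj
              | ==-false (≢-suc (adj⇒≢ ai)) | ==-false (≢-suc (adj⇒≢ aj))
        with E G i j
      ... | true = refl
      ... | false = refl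

  χ-K : χ K ≡ + 1
  χ-K = χ-cone K sK (suc b) apex
    (trans (sym (χ-iso sW (simple-∖ K sK (suc b)) cone-base)) (χ-iso sW (simple-S K sK (suc b)) cone-sphere))

  -- Refinement does not change χ: delete a, then the new vertex, whose sphere K has χ = 1.
  χ-G′ : χ G′ ≡ χ G
  χ-G′ = begin
    χ G′                                                   ≡⟨ χ-delete G′ simple-G′ (suc a) va ⟩
    χ (G′ ∖ suc a) + (+ 1 - χ (S G′ (suc a)))
      ≡⟨ cong₂ (λ x y → x + (+ 1 - y)) (χ-delete (G′ ∖ suc a) sD zero refl)
                                       (sym (χ-iso (simple-S G sG a) (simple-S G′ simple-G′ (suc a)) sphere-a)) ⟩
    (χ ((G′ ∖ suc a) ∖ zero) + (+ 1 - χ K)) + (+ 1 - χ (S G a))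
      ≡⟨ cong₂ (λ x y → (x + (+ 1 - y)) + (+ 1 - χ (S G a)))
               (sym (χ-iso (simple-∖ G sG a) (simple-∖ _ sD zero) delete-a-new)) χ-K ⟩
    (χ (G ∖ a) + (+ 1 - + 1)) + (+ 1 - χ (S G a))
      ≡⟨ cong (λ x → x + (+ 1 - χ (S G a))) (ℤP.+-identityʳ (χ (G ∖ a))) ⟩
    χ (G ∖ a) + (+ 1 - χ (S G a))                          ≡⟨ sym (χ-delete G sG a va) ⟩
    χ G ∎
    where open ≡-Reasoning
          sD : IsSimple (G′ ∖ suc a)
          sD = simple-∖ G′ simple-G′ (suc a)

  sphere-new : Iso (Susp W) (S G′ zero)
  sphere-new = record { φ = φ ; ψ = ψ ; Vφ = Vφ ; Vψ = Vψ ; φψ = φψ ; inj = inj ; Eφ = Eφ }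
    where
    φ : Fin (suc (suc (n G))) → Fin (suc (n G))
    φ zero = suc a
    φ (suc zero) = suc b
    φ (suc (suc i)) = suc i
    pick : Fin (n G) → Fin (suc (suc (n G)))
    pick z with z ≟ a | z ≟ b
    ... | yes _ | _ = zero
    ... | no _ | yes _ = suc zero
    ... | no _ | no _ = suc (suc z)
    ψ : (y : Fin (suc (n G))) → V (S G′ zero) y ≡ true → Fin (suc (suc (n G)))
    ψ (suc z) _ = pick z
    Vφ : ∀ x → suspV W x ≡ true → V (S G′ zero) (φ x) ≡ true
    Vφ zero _ rewrite ==-refl a = refl
    Vφ (suc zero) _ rewrite b==a | ==-refl b = refl
    Vφ (suc (suc i)) vi with common vi
    ... | ai , bi rewrite adj⇒≠ ai | adj⇒≠ bi | ai | bi = refl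
    Vψ : ∀ y p → suspV W (ψ y p) ≡ true
    Vψ (suc z) p with z ≟ a | z ≟ b
    ... | yes _ | _ = refl
    ... | no _ | yes _ = refl
    ... | no _ | no _ rewrite eab = p
    φψ : ∀ y p → φ (ψ y p) ≡ y
    φψ (suc z) p with z ≟ a | z ≟ b
    ... | yes refl | _ = refl
    ... | no _ | yes refl = refl
    ... | no _ | no _ = refl
    inj : ∀ x y → suspV W x ≡ true → suspV W y ≡ true → φ x ≡ φ y → x ≡ y
    inj zero zero _ _ _ = refl
    inj zero (suc zero) _ _ e = ⊥-elim (a≢b (suc-injective e))
    inj zero (suc (suc j)) _ vj e = ⊥-elim (adj⇒≢ (proj₁ (common vj)) (sym (suc-injective e)))
    inj (suc zero) zero _ _ e = ⊥-elim (a≢b (sym (suc-injective e)))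
    inj (suc zero) (suc zero) _ _ _ = refl
    inj (suc zero) (suc (suc j)) _ vj e = ⊥-elim (adj⇒≢ (proj₂ (common vj)) (sym (suc-injective e)))
    inj (suc (suc i)) zero vi _ e = ⊥-elim (adj⇒≢ (proj₁ (common vi)) (suc-injective e))
    inj (suc (suc i)) (suc zero) vi _ e = ⊥-elim (adj⇒≢ (proj₂ (common vi)) (suc-injective e))
    inj (suc (suc i)) (suc (suc j)) _ _ e = cong (λ t → suc (suc t)) (suc-injective e)
    poles : suspE W zero (suc zero) ≡ E (S G′ zero) (suc a) (suc b)
    poles rewrite b==a | ==-refl a | ==-refl b | eab = refl
    pole-a : ∀ j → Common j → suspE W zero (suc (suc j)) ≡ E (S G′ zero) (suc a) (suc j)
    pole-a j (aj , bj) rewrite a==b | ==-refl a | eab | aj | bj | adj⇒≠ aj | adj⇒≠ bj = refl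
    pole-b : ∀ j → Common j → suspE W (suc zero) (suc (suc j)) ≡ E (S G′ zero) (suc b) (suc j)
    pole-b j (aj , bj) rewrite ==-refl b | b==a | eab | aj | bj | adj⇒≠ aj | adj⇒≠ bj = refl
    equator : ∀ i j → Common i → Common j → suspE W (suc (suc i)) (suc (suc j)) ≡ E (S G′ zero) (suc i) (suc j)
    equator i j (ai , bi) (aj , bj)
      rewrite eab | ai | bi | aj | bj | adj⇒≠ ai | adj⇒≠ bi | adj⇒≠ aj | adj⇒≠ bj = sym (BP.∧-identityʳ _)
    flipped : ∀ x y → suspE W x y ≡ E (S G′ zero) (φ x) (φ y) → suspE W y x ≡ E (S G′ zero) (φ y) (φ x)
    flipped x y e = trans (IsSimple.sym (simple-Susp W sW) y x)
                          (trans e (IsSimple.sym (simple-S G′ simple-G′ zero) (φ x) (φ y)))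
    Eφ : ∀ x y → suspV W x ≡ true → suspV W y ≡ true → suspE W x y ≡ E (S G′ zero) (φ x) (φ y)
    Eφ zero zero _ _ rewrite ==-refl a | irrefl a = refl
    Eφ zero (suc zero) _ _ = poles
    Eφ zero (suc (suc j)) _ vj = pole-a j (common vj)
    Eφ (suc zero) zero _ _ = flipped zero (suc zero) poles
    Eφ (suc zero) (suc zero) _ _ rewrite ==-refl b | b==a | irrefl b = refl
    Eφ (suc zero) (suc (suc j)) _ vj = pole-b j (common vj)
    Eφ (suc (suc i)) zero vi _ = flipped zero (suc (suc i)) (pole-a i (common vi))
    Eφ (suc (suc i)) (suc zero) vi _ = flipped (suc zero) (suc (suc i)) (pole-b i (common vi))
    Eφ (suc (suc i)) (suc (suc j)) vi vj = equator i j (common vi) (common vj)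

  sphere-common : ∀ z → Common z → Iso (refine (S G z) a b) (S G′ (suc z))
  sphere-common z (az , bz) = idIso _ _ _ _ sameV sameE
    where
    za : E G z a ≡ true
    za = trans (IsSimple.sym sG z a) az
    zb : E G z b ≡ true
    zb = trans (IsSimple.sym sG z b) bz
    sameV : ∀ u → V (refine (S G z) a b) u ≡ V (S G′ (suc z)) u
    sameV zero rewrite adj⇒≠ az | adj⇒≠ bz | az | bz = refl
    sameV (suc w) rewrite adj⇒≠ az | adj⇒≠ bz = sym (BP.∧-identityʳ _)
    sameE : ∀ u v → V (refine (S G z) a b) u ≡ true → V (refine (S G z) a b) v ≡ true →
            E (refine (S G z) a b) u v ≡ E (S G′ (suc z)) u v
    sameE zero zero _ _ rewrite adj⇒≠ az | adj⇒≠ bz | az | bz = refl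
    sameE zero (suc w) _ zw rewrite adj⇒≠ az | adj⇒≠ bz | za | zb | az | bz | zw = refl
    sameE (suc w) zero zw _ rewrite adj⇒≠ az | adj⇒≠ bz | za | zb | az | bz | zw = refl
    sameE (suc i) (suc j) zi zj rewrite adj⇒≠ az | adj⇒≠ bz | zi | zj = refl

  noCommon : ∀ {z} → E G a z ∧ E G b z ≡ false → E G z a ≡ true → E G z b ≡ true → ⊥
  noCommon notCommon za zb = true≢false (trans (sym (cong₂ _∧_ (trans (IsSimple.sym sG a _) za)
                                                              (trans (IsSimple.sym sG b _) zb))) notCommon)

  notAB : ∀ z → E G a z ∧ E G b z ≡ false → ∀ i j → E G z i ≡ true → E G z j ≡ true →
          ((i == a) ∧ (j == b)) ∨ ((i == b) ∧ (j == a)) ≡ false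
  notAB z notCommon i j zi zj with i ≟ a | j ≟ b | i ≟ b | j ≟ a
  ... | yes refl | yes refl | _ | _ = ⊥-elim (noCommon notCommon zi zj)
  ... | _ | _ | yes refl | yes refl = ⊥-elim (noCommon notCommon zj zi)
  ... | yes _ | no _ | yes _ | no _ = refl
  ... | yes _ | no _ | no _ | _ = refl
  ... | no _ | _ | yes _ | no _ = refl
  ... | no _ | _ | no _ | _ = refl

  sphere-other : ∀ z → z ≢ a → z ≢ b → E G a z ∧ E G b z ≡ false → Iso (S G z) (S G′ (suc z))
  sphere-other z z≢a z≢b notCommon = shiftIso (S G z) _ _ notNew sameV sameE
    where
    notNew : V (S G′ (suc z)) zero ≡ false
    notNew rewrite ==-false z≢a | ==-false z≢b = notCommon
    sameV : ∀ y → V (S G′ (suc z)) (suc y) ≡ E G z y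
    sameV y rewrite ==-false z≢a | ==-false z≢b = BP.∧-identityʳ _
    sameE : ∀ i j → E G z i ≡ true → E G z j ≡ true → E (S G z) i j ≡ E (S G′ (suc z)) (suc i) (suc j)
    sameE i j zi zj rewrite ==-false z≢a | ==-false z≢b | notAB z notCommon i j zi zj | zi | zj =
      sym (BP.∧-identityʳ _)

RefinementClosed : ℕ → Set
RefinementClosed k = (G : Graph) → IsSimple G → 𝒳 k G →
  (a b : Fin′ G) → E G a b ≡ true → 𝒳 k (refine G a b)

-- In dimensions -1 and 0 there are no edges at all.
closed-1 : RefinementClosed 0
closed-1 G sG empty a b eab = ⊥-elim (true≢false (trans (sym (proj₁ (IsSimple.inV sG a b eab))) (empty a)))

closed₀ : RefinementClosed 1
closed₀ G sG (_ , spheres) a b eab =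
  ⊥-elim (true≢false (trans (sym eab) (spheres a (proj₁ (IsSimple.inV sG a b eab)) b)))

-- Inductive step: χ is unchanged, and each unit sphere of G′ is (isomorphic to)
-- a sphere of G, the suspension of the link W, or a refined sphere of G.
closed-step : ∀ j → RefinementClosed (suc j) → RefinementClosed (suc (suc j))
closed-step j IH G sG (χG , spheres) a b eab = trans χ-G′ χG , spheres′
  where
  open Refinement G sG a b eab
  sS′ : ∀ x → IsSimple (S G′ x)
  sS′ = simple-S G′ simple-G′

  oldSphere : ∀ z → V G z ≡ true → Dec (z ≡ a) → Dec (z ≡ b) →
              ∀ c → E G a z ∧ E G b z ≡ c → 𝒳 (suc j) (S G′ (suc z))
  oldSphere z vz (yes refl) _ _ _ =
    𝒳-iso (suc j) (simple-S G sG a) (sS′ (suc a)) sphere-a (spheres a va)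
  oldSphere z vz (no _) (yes refl) _ _ =
    𝒳-iso (suc j) (simple-S G sG b) (sS′ (suc b))
      (isoTrans (Refinement.sphere-a G sG b a eba) (iso-S (refine-swap G a b) sGba simple-G′ (suc b) vb))
      (spheres b vb)
    where sGba : IsSimple (refine G b a)
          sGba = Refinement.simple-G′ G sG b a eba
  oldSphere z vz (no _) (no _) true isCommon =
    𝒳-iso (suc j) (Refinement.simple-G′ (S G z) sSz a b ab∈Sz) (sS′ (suc z)) (sphere-common z (az , bz))
      (IH (S G z) sSz (spheres z vz) a b ab∈Sz)
    where
    az : E G a z ≡ true
    az = proj₁ (∧-el isCommon)
    bz : E G b z ≡ true
    bz = proj₂ (∧-el {E G a z} isCommon)
    sSz : IsSimple (S G z)
    sSz = simple-S G sG z
    ab∈Sz : E (S G z) a b ≡ true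
    ab∈Sz = ∧-in (trans (IsSimple.sym sG z a) az) (∧-in (trans (IsSimple.sym sG z b) bz) eab)
  oldSphere z vz (no z≢a) (no z≢b) false notCommon =
    𝒳-iso (suc j) (simple-S G sG z) (sS′ (suc z)) (sphere-other z z≢a z≢b notCommon) (spheres z vz)

  -- The new vertex: its sphere is the suspension of the link W ∈ 𝒳_{d-2}.
  spheres′ : ∀ x → V G′ x ≡ true → 𝒳 (suc j) (S G′ x)
  spheres′ zero _ = 𝒳-iso (suc j) (simple-Susp W sW) (sS′ zero) sphere-new
                      (susp-𝒳 j W sW (proj₂ (spheres a va) b eab))
  spheres′ (suc z) vz = oldSphere z vz (z ≟ a) (z ≟ b) (E G a z ∧ E G b z) refl

refinementClosed : ∀ k → RefinementClosed k
refinementClosed zero = closed-1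
refinementClosed (suc zero) = closed₀
refinementClosed (suc (suc j)) = closed-step j (refinementClosed (suc j))

mainTheorem7 : (k : ℕ) (G : Graph) → IsSimple G → 𝒳 k G →
    (a b : Fin′ G) → E G a b ≡ true → 𝒳 k (refine G a b)
mainTheorem7 = refinementClosed
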